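{- Let $k$ and $n$ be positive integers, and let $S_n$ denote the edgeless graph on $n$ vertices. Then $\Gamma(K_n\,\square\, K_k[S_n])=n\cdot k$.
   Context: $K_n$ is the complete graph on $n$ vertices. The lexicographic product $G[H]$ has vertex set $V(G)\times V(H)$, and $(a,x)(b,y)$ is an edge iff $ab\in E(G)$, or $a=b$ and $xy\in E(H)$. The Cartesian product $G\,\square\, H$ has vertex set $V(G)\times V(H)$, and $(a,x)(b,y)$ is an edge iff either $a=b$ and $xy\in E(H)$, or $ab\in E(G)$ and $x=y$. A greedy $k$-colouring of a graph is a partition of its vertex set into $k$ nonempty stable sets $S_1,\dots,S_k$ such that for every $j<i$, every vertex of $S_i$ has a neighbour in $S_j$. The Grundy number $\Gamma$ is the largest such $k$. -}

module Defs where

open import Data.Nat using (ℕ)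
open import Data.Fin using (Fin; _<_)
open import Data.Product using (_×_; ∃; _,_)
open import Data.Sum using (_⊎_)
open import Data.Empty using (⊥)
open import Relation.Binary.PropositionalEquality using (_≡_; _≢_)

record Graph : Set₁ where
  field
    V   : Set
    Adj : V → V → Set
open Graph public

K : ℕ → Graph
K n = record { V = Fin n ; Adj = λ a b → a ≢ b }

S : ℕ → Graph
S n = record { V = Fin n ; Adj = λ _ _ → ⊥ }

lex : Graph → Graph → Graph
lex G H = record
  { V   = V G × V H
  ; Adj = λ { (a , x) (b , y) → Adj G a b ⊎ (a ≡ b × Adj H x y) } }

cart : Graph → Graph → Graph
cart G H = record
  { V   = V G × V H
  ; Adj = λ { (a , x) (b , y) → (a ≡ b × Adj H x y) ⊎ (Adj G a b × x ≡ y) } }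

record GreedyColouring (G : Graph) (m : ℕ) : Set where
  field
    col      : V G → Fin m
    nonempty : ∀ (i : Fin m) → ∃ λ v → col v ≡ i
    stable   : ∀ u v → Adj G u v → col u ≢ col v
    greedy   : ∀ v (j : Fin m) → j < col v → ∃ λ u → Adj G v u × col u ≡ j

GrundyNumberIs : Graph → ℕ → Set
GrundyNumberIs G g = GreedyColouring G g × (∀ m → GreedyColouring G m → m Data.Nat.≤ g)

-- A vertex of the highest colour in a greedy colouring has every colour in its
-- closed neighbourhood, so Γ(G) is at most the size of a largest closed
-- neighbourhood; in K_n □ K_k[S_n] every closed neighbourhood has n·k vertices.
-- Conversely, writing vertices as (a, b, x) with a, x ∈ ℤ/n and b ∈ K_k, the
-- colouring (a + x, b) is proper and every vertex sees all other n·k − 1 colours,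
-- which makes it a greedy colouring with n·k colours.
module Submission where

open import Defs
open import Data.Nat using (ℕ; _*_; _≤_)
open import Data.Nat as ℕ using (zero; suc; _+_; _∸_; _%_; NonZero; z≤n)
open import Data.Nat.Properties as ℕ using (+-comm; +-assoc; m+[n∸m]≡n; m∸n+n≡m)
open import Data.Nat.DivMod using (%-distribˡ-+; m%n%n≡m%n; m%n<n; m<n⇒m%n≡m; [m+n]%n≡m%n)
open import Data.Fin as Fin using (Fin; toℕ; fromℕ; fromℕ<; combine)
open import Data.Fin.Properties using (toℕ-fromℕ<; toℕ-injective; toℕ<n; _≟_; <⇒≢; <-cmp; ≤fromℕ; injective⇒≤; combine-injective; combine-injectiveˡ; combine-injectiveʳ; combine-surjective)
open import Data.Product using (Σ; ∃; _×_; _,_; proj₁; proj₂; uncurry)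
open import Data.Bool using (if_then_else_)
open import Data.Sum using (_⊎_; inj₁; inj₂)
open import Function using (_∘_)
open import Relation.Binary.Definitions using (tri<; tri≈; tri>)
open import Relation.Nullary using (does; yes; no; contradiction)
open import Relation.Binary.PropositionalEquality

ClosedNeighbour : (G : Graph) → V G → V G → Set
ClosedNeighbour G v u = u ≡ v ⊎ Adj G v u

ClosedNeighbourhoodsInjectInto : Graph → ℕ → Set
ClosedNeighbourhoodsInjectInto G N =
  ∀ v → Σ (V G → Fin N) λ f →
    ∀ {u w} → ClosedNeighbour G v u → ClosedNeighbour G v w → f u ≡ f w → u ≡ w

module _ {G : Graph} {m : ℕ} (C : GreedyColouring G (suc m)) where
  open GreedyColouring C

  greedy-top-sees-all-colours :
    ∃ λ v → ∀ j → ∃ λ u → ClosedNeighbour G v u × col u ≡ j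
  greedy-top-sees-all-colours = v , sees
    where
    v = proj₁ (nonempty (fromℕ m))
    col-v≡top = proj₂ (nonempty (fromℕ m))

    sees : ∀ j → ∃ λ u → ClosedNeighbour G v u × col u ≡ j
    sees j with <-cmp j (col v)
    ... | tri< j<c _ _ = let u , v~u , cu≡j = greedy v j j<c in u , inj₂ v~u , cu≡j
    ... | tri≈ _ j≡c _ = v , inj₁ refl , sym j≡c
    ... | tri> _ _ c<j = contradiction (subst (j Fin.≤_) (sym col-v≡top) (≤fromℕ j)) (ℕ.<⇒≱ c<j)

greedyColouring-≤ : ∀ {G N m} → ClosedNeighbourhoodsInjectInto G N →
                    GreedyColouring G m → m ≤ N
greedyColouring-≤ {m = zero}  _   _ = z≤n
greedyColouring-≤ {G} {m = suc m} nbd C = injective⇒≤ {f = f ∘ witness} injective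
  where
  open GreedyColouring C
  v     = proj₁ (greedy-top-sees-all-colours C)
  sees  = proj₂ (greedy-top-sees-all-colours C)
  f     = proj₁ (nbd v)
  witness : Fin (suc m) → V G
  witness j = proj₁ (sees j)
  injective : ∀ {i j} → f (witness i) ≡ f (witness j) → i ≡ j
  injective {i} {j} e = begin
    i                ≡⟨ sym (proj₂ (proj₂ (sees i))) ⟩
    col (witness i)  ≡⟨ cong col (proj₂ (nbd v) (proj₁ (proj₂ (sees i))) (proj₁ (proj₂ (sees j))) e) ⟩
    col (witness j)  ≡⟨ proj₂ (proj₂ (sees j)) ⟩
    j                ∎
    where open ≡-Reasoning

record FallColouring (G : Graph) (m : ℕ) : Set where
  field
    col        : V G → Fin m
    surjective : ∀ i → ∃ λ v → col v ≡ i
    stable     : ∀ u v → Adj G u v → col u ≢ col v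
    colourful  : ∀ v i → i ≢ col v → ∃ λ u → Adj G v u × col u ≡ i

fallColouring⇒greedyColouring : ∀ {G m} → FallColouring G m → GreedyColouring G m
fallColouring⇒greedyColouring F = record
  { col      = col
  ; nonempty = surjective
  ; stable   = stable
  ; greedy   = λ v j j<c → colourful v j (<⇒≢ j<c)
  }
  where open FallColouring F

[m%n+o]%n≡[m+o]%n : ∀ m o n .{{_ : NonZero n}} → (m % n + o) % n ≡ (m + o) % n
[m%n+o]%n≡[m+o]%n m o n = begin
  (m % n + o) % n          ≡⟨ %-distribˡ-+ (m % n) o n ⟩
  (m % n % n + o % n) % n  ≡⟨ cong (λ t → (t + o % n) % n) (m%n%n≡m%n m n) ⟩
  (m % n + o % n) % n      ≡⟨ %-distribˡ-+ m o n ⟨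
  (m + o) % n              ∎
  where open ≡-Reasoning

module ModularAddition (n : ℕ) .{{_ : NonZero n}} where

  rotate : ℕ → Fin n → Fin n
  rotate p a = fromℕ< (m%n<n (toℕ a + p) n)

  rotate-cancel : ∀ {p q} → p + q ≡ n → ∀ a → rotate q (rotate p a) ≡ a
  rotate-cancel {p} {q} p+q≡n a = toℕ-injective (begin
    toℕ (rotate q (rotate p a))  ≡⟨ toℕ-fromℕ< _ ⟩
    (toℕ (rotate p a) + q) % n    ≡⟨ cong (λ t → (t + q) % n) (toℕ-fromℕ< _) ⟩
    ((toℕ a + p) % n + q) % n     ≡⟨ [m%n+o]%n≡[m+o]%n (toℕ a + p) q n ⟩
    (toℕ a + p + q) % n           ≡⟨ cong (_% n) (trans (+-assoc (toℕ a) p q) (cong (toℕ a +_) p+q≡n)) ⟩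
    (toℕ a + n) % n               ≡⟨ [m+n]%n≡m%n (toℕ a) n ⟩
    toℕ a % n                     ≡⟨ m<n⇒m%n≡m (toℕ<n a) ⟩
    toℕ a                         ∎)
    where open ≡-Reasoning

  _⊕_ : Fin n → Fin n → Fin n
  a ⊕ x = rotate (toℕ x) a

  ⊕-comm : ∀ a x → a ⊕ x ≡ x ⊕ a
  ⊕-comm a x = toℕ-injective (begin
    toℕ (a ⊕ x)          ≡⟨ toℕ-fromℕ< _ ⟩
    (toℕ a + toℕ x) % n  ≡⟨ cong (_% n) (+-comm (toℕ a) (toℕ x)) ⟩
    (toℕ x + toℕ a) % n  ≡⟨ toℕ-fromℕ< _ ⟨
    toℕ (x ⊕ a)          ∎)
    where open ≡-Reasoning

  ⊕-cancelʳ : ∀ {a a′} x → a ⊕ x ≡ a′ ⊕ x → a ≡ a′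
  ⊕-cancelʳ {a} {a′} x e = begin
    a                              ≡⟨ rotate-cancel x+x⁻≡n a ⟨
    rotate (n ∸ toℕ x) (a ⊕ x)     ≡⟨ cong (rotate (n ∸ toℕ x)) e ⟩
    rotate (n ∸ toℕ x) (a′ ⊕ x)    ≡⟨ rotate-cancel x+x⁻≡n a′ ⟩
    a′                             ∎
    where
    open ≡-Reasoning
    x+x⁻≡n = m+[n∸m]≡n (ℕ.<⇒≤ (toℕ<n x))

  ⊕-solveˡ : ∀ x r → ∃ λ a → a ⊕ x ≡ r
  ⊕-solveˡ x r = rotate (n ∸ toℕ x) r , rotate-cancel (m∸n+n≡m (ℕ.<⇒≤ (toℕ<n x))) r

  ⊕-solveʳ : ∀ a r → ∃ λ x → a ⊕ x ≡ r
  ⊕-solveʳ a r = let x , x⊕a≡r = ⊕-solveˡ a r in x , trans (⊕-comm a x) x⊕a≡r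

KnKkSn : ℕ → ℕ → Graph
KnKkSn n k = cart (K n) (lex (K k) (S n))

module _ {n k : ℕ} where

  data ClosedNbhdForm (a : Fin n) (b : Fin k) (x : Fin n) : V (KnKkSn n k) → Set where
    vary-Kn     : ∀ a′ → ClosedNbhdForm a b x (a′ , b , x)
    other-block : ∀ {b′} x′ → b′ ≢ b → ClosedNbhdForm a b x (a , b′ , x′)

  closedNeighbour⇒ClosedNbhdForm : ∀ {a b x u} →
                                   ClosedNeighbour (KnKkSn n k) (a , b , x) u →
                                   ClosedNbhdForm a b x u
  closedNeighbour⇒ClosedNbhdForm (inj₁ refl)                      = vary-Kn _
  closedNeighbour⇒ClosedNbhdForm (inj₂ (inj₁ (refl , inj₁ b≢b′))) = other-block _ (b≢b′ ∘ sym)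
  closedNeighbour⇒ClosedNbhdForm (inj₂ (inj₂ (_ , refl)))         = vary-Kn _

  nbhdCode : Fin k → V (KnKkSn n k) → Fin n × Fin k
  nbhdCode b (a′ , b′ , x′) = (if does (b′ ≟ b) then a′ else x′) , b′

  nbhdDecode : Fin n → Fin k → Fin n → Fin n × Fin k → V (KnKkSn n k)
  nbhdDecode a b x (c , b′) = if does (b′ ≟ b) then (c , b′ , x) else (a , b′ , c)

  nbhdDecode-nbhdCode : ∀ {a b x u} → ClosedNbhdForm a b x u →
                        nbhdDecode a b x (nbhdCode b u) ≡ u
  nbhdDecode-nbhdCode {b = b} (vary-Kn _) with b ≟ b
  ... | yes _   = refl
  ... | no  b≢b = contradiction refl b≢b
  nbhdDecode-nbhdCode {b = b} (other-block {b′} _ b′≢b) with b′ ≟ b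
  ... | yes b′≡b = contradiction b′≡b b′≢b
  ... | no  _    = refl

  closedNeighbourhoods-KnKkSn : ClosedNeighbourhoodsInjectInto (KnKkSn n k) (n * k)
  closedNeighbourhoods-KnKkSn (a , b , x) = uncurry combine ∘ nbhdCode b , injective
    where
    injective : ∀ {u w} → ClosedNeighbour (KnKkSn n k) (a , b , x) u →
                ClosedNeighbour (KnKkSn n k) (a , b , x) w →
                uncurry combine (nbhdCode b u) ≡ uncurry combine (nbhdCode b w) → u ≡ w
    injective {u} {w} u~ w~ e = begin
      u                                ≡⟨ nbhdDecode-nbhdCode (closedNeighbour⇒ClosedNbhdForm u~) ⟨
      nbhdDecode a b x (nbhdCode b u)  ≡⟨ cong (nbhdDecode a b x) (uncurry (cong₂ _,_) (combine-injective _ _ _ _ e)) ⟩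
      nbhdDecode a b x (nbhdCode b w)  ≡⟨ nbhdDecode-nbhdCode (closedNeighbour⇒ClosedNbhdForm w~) ⟩
      w                                ∎
      where open ≡-Reasoning

module _ (n k : ℕ) .{{_ : NonZero n}} where
  open ModularAddition n

  latinColour : V (KnKkSn n k) → Fin (n * k)
  latinColour (a , b , x) = combine (a ⊕ x) b

  fallColouring-KnKkSn : FallColouring (KnKkSn n k) (n * k)
  fallColouring-KnKkSn = record
    { col        = latinColour
    ; surjective = surjective
    ; stable     = stable
    ; colourful  = colourful
    }
    where
    surjective : ∀ i → ∃ λ v → latinColour v ≡ i
    surjective i with r , b , refl ← combine-surjective {n} i
      = let a , a⊕r≡r = ⊕-solveˡ r r in (a , b , r) , cong (λ t → combine t b) a⊕r≡r

    stable : ∀ u v → Adj (KnKkSn n k) u v → latinColour u ≢ latinColour v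
    stable (a , b , x) (_ , b′ , x′) (inj₁ (refl , inj₁ b≢b′)) e =
      b≢b′ (combine-injectiveʳ (a ⊕ x) b (a ⊕ x′) b′ e)
    stable _ _ (inj₁ (refl , inj₂ (_ , ())))
    stable _ _ (inj₂ (a≢a′ , refl)) e = a≢a′ (⊕-cancelʳ _ (combine-injectiveˡ _ _ _ _ e))

    colourful  : ∀ v i → i ≢ latinColour v → ∃ λ u → Adj (KnKkSn n k) v u × latinColour u ≡ i
    colourful (a , b , x) i i≢c with r , b′ , refl ← combine-surjective {n} i | b′ ≟ b
    ... | no b′≢b =
      let x′ , a⊕x′≡r = ⊕-solveʳ a r
      in (a , b′ , x′) , inj₁ (refl , inj₁ (b′≢b ∘ sym)) , cong (λ t → combine t b′) a⊕x′≡r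
    ... | yes refl =
      let a′ , a′⊕x≡r = ⊕-solveˡ x r
          colour≡i    = cong (λ t → combine t b) a′⊕x≡r
      in (a′ , b , x) , inj₂ ((λ { refl → i≢c (sym colour≡i) }) , refl) , colour≡i

proposition30 : ∀ (k n : ℕ) → 1 ≤ k → 1 ≤ n →
    GrundyNumberIs (cart (K n) (lex (K k) (S n))) (n * k)
proposition30 k n@(suc _) _ _ =
  fallColouring⇒greedyColouring (fallColouring-KnKkSn n k) ,
  λ _ → greedyColouring-≤ closedNeighbourhoods-KnKkSn
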